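{- Let $v,d\ge0$. Every characteristic minmatrix in $\mathbf{E}[v,d]$ (i.e. every $\langle\mathbf{S}\rangle_{v,d}$ for a classical modal logic $\mathbf{S}$), viewed as a set of level-$d$ minterms, is a union of complete prime orbits.
   Context: Language: variables $p_1,p_2,\dots$, constants $0,1$, connectives $\neg,\vee,\wedge$, modal operator $\lozenge$. $\mathbf{E}$ is the smallest set of formulas containing all tautologies and closed under modus ponens, uniform substitution and RE (from $\varphi\leftrightarrow\psi$ infer $\lozenge\varphi\leftrightarrow\lozenge\psi$); a classical modal logic is a set of formulas containing $\mathbf{E}$ closed under these rules. $\varphi\approx\psi$ means $\vdash_{\mathbf{E}}\varphi\leftrightarrow\psi$. $\mathcal{F}(v,d)$: formulas in $p_1,\dots,p_v$ of $\lozenge$-depth $\le d$; $\mathbf{E}[v,d]=\mathcal{F}(v,d)/\approx$. DCF minterms (fixed $v$): level-0 minterms are $\pm p_1\wedge\dots\wedge\pm p_v$; DCF formulas of $\mathcal{F}(v,0)$ are disjunctions of sets of distinct level-0 minterms; for $d\ge1$ the level-$d$ modal factors are $\lozenge\phi$ for every DCF formula $\phi$ of $\mathcal{F}(v,d-1)$, a level-$d$ minterm is a level-0 minterm conjoined with every level-$d$ modal factor, each plain or negated, and DCF formulas of $\mathcal{F}(v,d)$ are disjunctions of sets of distinct level-$d$ minterms. Every formula of $\mathcal{F}(v,d)$ is $\approx$ to a unique DCF formula, so elements of $\mathbf{E}[v,d]$ are identified with sets of level-$d$ minterms. Characteristic minmatrix: for a classical modal logic $\mathbf{S}$, $\langle\mathbf{S}\rangle_{v,d}$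 is the intersection of the minterm sets of all $\mathbf{S}$-theorems in $\mathcal{F}(v,d)$. Prime orbits: a level-0 substitution is a tuple $\sigma=(\sigma_1,\dots,\sigma_v)$ of non-modal formulas in $p_1,\dots,p_v$ (up to $\approx$), acting by $\varphi\mapsto\varphi\circ\sigma$ (replace each $p_i$ by $\sigma_i$); under composition $(\sigma\sigma')_i=\sigma_i(\sigma'_1,\dots,\sigma'_v)$ they form a monoid whose invertible elements form the group $\mathcal{S}_p(v,0)$ of prime substitutions. For prime $\varsigma$ and a level-$d$ minterm $\mu$, $\mu\circ\varsigma$ is $\approx$ to a single level-$d$ minterm; the orbits of the resulting action on level-$d$ minterms are the prime orbits. -}

module Defs where

open import Data.Nat using (ℕ; zero; suc; _<_; _≤_; _⊔_; _<?_)
open import Data.Bool using (Bool; true; false; if_then_else_; _∧_; _∨_; not)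
open import Data.Fin using (Fin; toℕ; fromℕ<)
open import Data.Fin.Subset using (Subset; _∈_)
open import Data.List using (List; []; _∷_; _++_; map; concatMap; length; lookup)
open import Data.Vec as Vec using (Vec; []; _∷_; fromList)
open import Data.Product using (Σ; _×_; _,_)
open import Data.Unit using (⊤)
open import Relation.Nullary using (yes; no)
open import Relation.Binary.PropositionalEquality using (_≡_)

-- Syntax.  Variables p₁,p₂,… are  var 0, var 1, … (0-indexed).

infixr 6 _∧′_
infixr 5 _∨′_
infixr 4 _⇒′_ _⇔′_

data Fm : Set where
  var  : ℕ → Fm
  𝟘 𝟙  : Fm
  ¬′_  : Fm → Fm
  _∨′_ : Fm → Fm → Fm
  _∧′_ : Fm → Fm → Fm
  ◇    : Fm → Fm

_⇒′_ : Fm → Fm → Fm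
φ ⇒′ ψ = (¬′ φ) ∨′ ψ

_⇔′_ : Fm → Fm → Fm
φ ⇔′ ψ = (φ ⇒′ ψ) ∧′ (ψ ⇒′ φ)

-- Tautologies: true under every Boolean valuation of the variables and
-- of the (syntactically distinct) modal subformulas ◇ψ, treated as atoms.

eval : (ℕ → Bool) → (Fm → Bool) → Fm → Bool
eval val m (var i) = val i
eval val m 𝟘 = false
eval val m 𝟙 = true
eval val m (¬′ φ) = not (eval val m φ)
eval val m (φ ∨′ ψ) = eval val m φ ∨ eval val m ψ
eval val m (φ ∧′ ψ) = eval val m φ ∧ eval val m ψ
eval val m (◇ φ) = m φ

Tautology : Fm → Set
Tautology φ = ∀ (val : ℕ → Bool) (m : Fm → Bool) → eval val m φ ≡ true

subst : (ℕ → Fm) → Fm → Fm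
subst σ (var i) = σ i
subst σ 𝟘 = 𝟘
subst σ 𝟙 = 𝟙
subst σ (¬′ φ) = ¬′ subst σ φ
subst σ (φ ∨′ ψ) = subst σ φ ∨′ subst σ ψ
subst σ (φ ∧′ ψ) = subst σ φ ∧′ subst σ ψ
subst σ (◇ φ) = ◇ (subst σ φ)

data ⊢E : Fm → Set where
  taut : ∀ {φ} → Tautology φ → ⊢E φ
  mp   : ∀ {φ ψ} → ⊢E φ → ⊢E (φ ⇒′ ψ) → ⊢E ψ
  us   : ∀ {φ} (σ : ℕ → Fm) → ⊢E φ → ⊢E (subst σ φ)
  re   : ∀ {φ ψ} → ⊢E (φ ⇔′ ψ) → ⊢E (◇ φ ⇔′ ◇ ψ)

_≈_ : Fm → Fm → Set
φ ≈ ψ = ⊢E (φ ⇔′ ψ)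

record ClassicalModalLogic (S : Fm → Set) : Set where
  field
    containsE : ∀ {φ} → ⊢E φ → S φ
    closedMP  : ∀ {φ ψ} → S φ → S (φ ⇒′ ψ) → S ψ
    closedUS  : ∀ {φ} (σ : ℕ → Fm) → S φ → S (subst σ φ)
    closedRE  : ∀ {φ ψ} → S (φ ⇔′ ψ) → S (◇ φ ⇔′ ◇ ψ)

depth : Fm → ℕ
depth (var i) = 0
depth 𝟘 = 0
depth 𝟙 = 0
depth (¬′ φ) = depth φ
depth (φ ∨′ ψ) = depth φ ⊔ depth ψ
depth (φ ∧′ ψ) = depth φ ⊔ depth ψ
depth (◇ φ) = suc (depth φ)

VarsBelow : ℕ → Fm → Set
VarsBelow v (var i) = i < v
VarsBelow v 𝟘 = ⊤
VarsBelow v 𝟙 = ⊤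
VarsBelow v (¬′ φ) = VarsBelow v φ
VarsBelow v (φ ∨′ ψ) = VarsBelow v φ × VarsBelow v ψ
VarsBelow v (φ ∧′ ψ) = VarsBelow v φ × VarsBelow v ψ
VarsBelow v (◇ φ) = VarsBelow v φ

InF : ℕ → ℕ → Fm → Set
InF v d φ = VarsBelow v φ × depth φ ≤ d

conj : List Fm → Fm
conj [] = 𝟙
conj (φ ∷ []) = φ
conj (φ ∷ φs) = φ ∧′ conj φs

disj : List Fm → Fm
disj [] = 𝟘
disj (φ ∷ []) = φ
disj (φ ∷ φs) = φ ∨′ disj φs

lit : Bool → Fm → Fm
lit b φ = if b then φ else ¬′ φ

signs : (n : ℕ) → List (Vec Bool n)
signs zero = [] ∷ []
signs (suc n) = map (true ∷_) (signs n) ++ map (false ∷_) (signs n)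

lits0 : ∀ {n} → ℕ → Vec Bool n → List Fm
lits0 i [] = []
lits0 i (b ∷ bs) = lit b (var i) ∷ lits0 (suc i) bs

select : ∀ {n} → Subset n → Vec Fm n → List Fm
select [] [] = []
select (true ∷ t) (φ ∷ φs) = φ ∷ select t φs
select (false ∷ t) (φ ∷ φs) = select t φs

dcfsOf : List Fm → List Fm
dcfsOf ms = map (λ t → disj (select t (fromList ms))) (signs (length ms))

mlits : List Bool → List Fm → List Fm
mlits (b ∷ bs) (φ ∷ φs) = lit b (◇ φ) ∷ mlits bs φs
mlits _ _ = []

minterms : ℕ → ℕ → List Fm
minterms v zero = map (λ s → conj (lits0 0 s)) (signs v)
minterms v (suc d) =
  concatMap (λ s → map (λ t → conj (lits0 0 s ++ mlits (Vec.toList t) (dcfsOf (minterms v d))))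
                       (signs (length (dcfsOf (minterms v d)))))
            (signs v)

N : ℕ → ℕ → ℕ
N v d = length (minterms v d)

Minterm : ℕ → ℕ → Set
Minterm v d = Fin (N v d)

mint : ∀ v d → Minterm v d → Fm
mint v d i = lookup (minterms v d) i

dcf : ∀ v d → Subset (N v d) → Fm
dcf v d t = disj (select t (fromList (minterms v d)))

-- minterm set of a formula: the minterms of its (unique) DCF
InMinSet : ∀ v d → Fm → Minterm v d → Set
InMinSet v d φ i = Σ (Subset (N v d)) (λ t → (φ ≈ dcf v d t) × (i ∈ t))

InChar : (Fm → Set) → ∀ v d → Minterm v d → Set
InChar S v d i = ∀ φ → S φ → InF v d φ → InMinSet v d φ i

Subst0 : ℕ → Set
Subst0 v = Fin v → Fm

IsLevel0Subst : ∀ v → Subst0 v → Set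
IsLevel0Subst v σ = ∀ i → InF v 0 (σ i)

extend : ∀ {v} → Subst0 v → ℕ → Fm
extend {v} σ k with k <? v
... | yes k<v = σ (fromℕ< k<v)
... | no _ = var k

_∘ₛ_ : ∀ {v} → Fm → Subst0 v → Fm
φ ∘ₛ σ = subst (extend σ) φ

-- prime = invertible in the monoid (composition (στ)ᵢ = σᵢ ∘ τ, identity pᵢ)
IsPrime : ∀ v → Subst0 v → Set
IsPrime v σ =
  IsLevel0Subst v σ ×
  Σ (Subst0 v) (λ τ → IsLevel0Subst v τ ×
     (∀ i → (σ i ∘ₛ τ) ≈ var (toℕ i)) ×
     (∀ i → (τ i ∘ₛ σ) ≈ var (toℕ i)))

SameOrbit : ∀ v d → Minterm v d → Minterm v d → Set
SameOrbit v d i j = Σ (Subst0 v) (λ ς → IsPrime v ς × ((mint v d i ∘ₛ ς) ≈ mint v d j))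

UnionOfPrimeOrbits : ∀ v d → (Minterm v d → Set) → Set
UnionOfPrimeOrbits v d M = ∀ i j → M i → SameOrbit v d i j → M j

module Submission where

-- A minterm μ belongs to the minterm set of φ exactly when ⊢ μ → φ.  Let μ be in ⟨S⟩
-- and μ ∘ ς ≈ μ′ for a prime ς with inverse τ.  For φ ∈ S ∩ F(v,d) the instance φ ∘ τ
-- is again in S ∩ F(v,d), so ⊢ μ → φ ∘ τ; substituting ς gives ⊢ μ ∘ ς → (φ ∘ τ) ∘ ς,
-- and (φ ∘ τ) ∘ ς ≈ φ by RE-congruence, because each τᵢ ∘ ς ≈ pᵢ.  Hence ⊢ μ′ → φ.

open import Defs
open import Data.Nat using (ℕ; _<_; _≤_; z≤n; s≤s; _<?_)
open import Data.Nat.Properties using (≤-trans; ≤-irrelevant; ⊔-mono-≤)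
open import Data.Bool using (Bool; true; false; _∧_; _∨_; not)
open import Data.Bool.Properties using (∨-identityʳ; ∨-zeroʳ; ∨-assoc; ∨-comm)
open import Data.Fin using (toℕ; fromℕ<) renaming (zero to fzero; suc to fsuc)
open import Data.Fin.Properties using (toℕ-fromℕ<)
open import Data.Fin.Subset using (Subset) renaming (_∈_ to _∈ₛ_)
open import Data.List using (List; []; _∷_)
open import Data.Bool.ListAction using (or)
import Data.List as List
open import Data.Vec using (Vec; []; _∷_; fromList; lookup; _[_]≔_)
open import Data.Vec.Properties using ([]=⇒lookup; []≔-lookup; []≔-updates)
open import Data.Product using (_,_; proj₁; proj₂)
open import Data.Unit using (tt)
open import Data.Empty using (⊥-elim)
open import Function using (_∘_)
open import Relation.Nullary using (yes; no)
open import Relation.Binary.PropositionalEquality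
  using (_≡_; refl; sym; trans; cong; cong₂; module ≡-Reasoning) renaming (subst to ≡-subst)

private
  variable
    φ ψ χ φ′ ψ′ : Fm

∨-absorbs-implied : ∀ {x y} → (y ≡ true → x ≡ true) → x ∨ y ≡ x
∨-absorbs-implied {x} {false} _ = ∨-identityʳ x
∨-absorbs-implied {x} {true}  f rewrite f refl = refl

-- Opaque so that eval does not unfold under it: the rules below can then infer the
-- formulas involved from goals of the form Holds val m (φ ⇒′ ψ).
opaque
  Holds : (ℕ → Bool) → (Fm → Bool) → Fm → Set
  Holds val m φ = eval val m φ ≡ true

opaque
  unfolding Holds

  Holds⁺ : ∀ {val m} → eval val m φ ≡ true → Holds val m φ
  Holds⁺ e = e

  Holds⁻ : ∀ {val m} → Holds val m φ → eval val m φ ≡ true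
  Holds⁻ h = h

  tautology : (∀ val m → Holds val m φ) → ⊢E φ
  tautology = taut

  ⇒-intro : ∀ {val m} → (Holds val m φ → Holds val m ψ) → Holds val m (φ ⇒′ ψ)
  ⇒-intro {φ} {val = val} {m} f with eval val m φ
  ... | true  = f refl
  ... | false = refl

  ⇒-elim : ∀ {val m} → Holds val m (φ ⇒′ ψ) → Holds val m φ → Holds val m ψ
  ⇒-elim h φ-holds rewrite φ-holds = h

  ⇔-intro : ∀ {val m} → eval val m φ ≡ eval val m ψ → Holds val m (φ ⇔′ ψ)
  ⇔-intro {ψ = ψ} {val} {m} e rewrite e with eval val m ψ
  ... | true  = refl
  ... | false = refl

  ⇔-elim : ∀ {val m} → Holds val m (φ ⇔′ ψ) → eval val m φ ≡ eval val m ψ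
  ⇔-elim {φ} {ψ} {val} {m} h with eval val m φ | eval val m ψ
  ... | true  | true  = refl
  ... | false | false = refl

  mp-tautological : ⊢E φ → (∀ val m → Holds val m φ → Holds val m ψ) → ⊢E ψ
  mp-tautological {φ} {ψ} ⊢φ f = mp ⊢φ (tautology λ val m → ⇒-intro {φ} {ψ} (f val m))

mp-tautological₂ : ⊢E φ → ⊢E ψ →
  (∀ val m → Holds val m φ → Holds val m ψ → Holds val m χ) → ⊢E χ
mp-tautological₂ ⊢φ ⊢ψ f = mp ⊢ψ (mp-tautological ⊢φ λ val m h → ⇒-intro (f val m h))

⇒-trans : ⊢E (φ ⇒′ ψ) → ⊢E (ψ ⇒′ χ) → ⊢E (φ ⇒′ χ)
⇒-trans p q = mp-tautological₂ p q λ _ _ e₁ e₂ → ⇒-intro (⇒-elim e₂ ∘ ⇒-elim e₁)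

≈⇒⇒ : φ ≈ ψ → ⊢E (φ ⇒′ ψ)
≈⇒⇒ p = mp-tautological p λ _ _ e → ⇒-intro λ h → Holds⁺ (trans (sym (⇔-elim e)) (Holds⁻ h))

≈⇒⇐ : φ ≈ ψ → ⊢E (ψ ⇒′ φ)
≈⇒⇐ p = mp-tautological p λ _ _ e → ⇒-intro λ h → Holds⁺ (trans (⇔-elim e) (Holds⁻ h))

≈-refl : ∀ φ → φ ≈ φ
≈-refl φ = tautology λ _ _ → ⇔-intro refl

¬-cong : φ ≈ ψ → (¬′ φ) ≈ (¬′ ψ)
¬-cong p = mp-tautological p λ _ _ e → ⇔-intro (cong not (⇔-elim e))

∨-cong : φ ≈ ψ → φ′ ≈ ψ′ → (φ ∨′ φ′) ≈ (ψ ∨′ ψ′)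
∨-cong p q = mp-tautological₂ p q λ _ _ e₁ e₂ → ⇔-intro (cong₂ _∨_ (⇔-elim e₁) (⇔-elim e₂))

∧-cong : φ ≈ ψ → φ′ ≈ ψ′ → (φ ∧′ φ′) ≈ (ψ ∧′ ψ′)
∧-cong p q = mp-tautological₂ p q λ _ _ e₁ e₂ → ⇔-intro (cong₂ _∧_ (⇔-elim e₁) (⇔-elim e₂))

subst-subst : ∀ σ ρ φ → subst σ (subst ρ φ) ≡ subst (subst σ ∘ ρ) φ
subst-subst σ ρ (var k)  = refl
subst-subst σ ρ 𝟘        = refl
subst-subst σ ρ 𝟙        = refl
subst-subst σ ρ (¬′ φ)   = cong ¬′_ (subst-subst σ ρ φ)
subst-subst σ ρ (φ ∨′ ψ) = cong₂ _∨′_ (subst-subst σ ρ φ) (subst-subst σ ρ ψ)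
subst-subst σ ρ (φ ∧′ ψ) = cong₂ _∧′_ (subst-subst σ ρ φ) (subst-subst σ ρ ψ)
subst-subst σ ρ (◇ φ)    = cong ◇ (subst-subst σ ρ φ)

subst-≈-id : ∀ {v} ρ → (∀ k → k < v → ρ k ≈ var k) → ∀ φ → VarsBelow v φ → subst ρ φ ≈ φ
subst-≈-id ρ ρ≈id (var k)  k<v       = ρ≈id k k<v
subst-≈-id ρ ρ≈id 𝟘        _         = ≈-refl 𝟘
subst-≈-id ρ ρ≈id 𝟙        _         = ≈-refl 𝟙
subst-≈-id ρ ρ≈id (¬′ φ)   vs        = ¬-cong (subst-≈-id ρ ρ≈id φ vs)
subst-≈-id ρ ρ≈id (φ ∨′ ψ) (vs , ws) = ∨-cong (subst-≈-id ρ ρ≈id φ vs) (subst-≈-id ρ ρ≈id ψ ws)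
subst-≈-id ρ ρ≈id (φ ∧′ ψ) (vs , ws) = ∧-cong (subst-≈-id ρ ρ≈id φ vs) (subst-≈-id ρ ρ≈id ψ ws)
subst-≈-id ρ ρ≈id (◇ φ)    vs        = re (subst-≈-id ρ ρ≈id φ vs)

VarsBelow-subst : ∀ {v} ρ → (∀ k → k < v → VarsBelow v (ρ k)) →
  ∀ φ → VarsBelow v φ → VarsBelow v (subst ρ φ)
VarsBelow-subst ρ hρ (var k)  k<v       = hρ k k<v
VarsBelow-subst ρ hρ 𝟘        _         = tt
VarsBelow-subst ρ hρ 𝟙        _         = tt
VarsBelow-subst ρ hρ (¬′ φ)   vs        = VarsBelow-subst ρ hρ φ vs
VarsBelow-subst ρ hρ (φ ∨′ ψ) (vs , ws) = VarsBelow-subst ρ hρ φ vs , VarsBelow-subst ρ hρ ψ ws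
VarsBelow-subst ρ hρ (φ ∧′ ψ) (vs , ws) = VarsBelow-subst ρ hρ φ vs , VarsBelow-subst ρ hρ ψ ws
VarsBelow-subst ρ hρ (◇ φ)    vs        = VarsBelow-subst ρ hρ φ vs

depth-subst-≤ : ∀ ρ → (∀ k → depth (ρ k) ≤ 0) → ∀ φ → depth (subst ρ φ) ≤ depth φ
depth-subst-≤ ρ hρ (var k)  = hρ k
depth-subst-≤ ρ hρ 𝟘        = z≤n
depth-subst-≤ ρ hρ 𝟙        = z≤n
depth-subst-≤ ρ hρ (¬′ φ)   = depth-subst-≤ ρ hρ φ
depth-subst-≤ ρ hρ (φ ∨′ ψ) = ⊔-mono-≤ (depth-subst-≤ ρ hρ φ) (depth-subst-≤ ρ hρ ψ)
depth-subst-≤ ρ hρ (φ ∧′ ψ) = ⊔-mono-≤ (depth-subst-≤ ρ hρ φ) (depth-subst-≤ ρ hρ ψ)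
depth-subst-≤ ρ hρ (◇ φ)    = s≤s (depth-subst-≤ ρ hρ φ)

extend-< : ∀ {v} (σ : Subst0 v) k (k<v : k < v) → extend σ k ≡ σ (fromℕ< k<v)
extend-< {v} σ k k<v with k <? v
... | yes k<v′ = cong (λ k<v″ → σ (fromℕ< k<v″)) (≤-irrelevant k<v′ k<v)
... | no  k≮v  = ⊥-elim (k≮v k<v)

InF-∘ₛ : ∀ {v d} (σ : Subst0 v) → IsLevel0Subst v σ → ∀ φ → InF v d φ → InF v d (φ ∘ₛ σ)
InF-∘ₛ {v} σ σ-level0 φ (vs , φ≤d) =
  VarsBelow-subst (extend σ) extend-vars φ vs ,
  ≤-trans (depth-subst-≤ (extend σ) extend-depth φ) φ≤d
  where
  extend-vars : ∀ k → k < v → VarsBelow v (extend σ k)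
  extend-vars k k<v rewrite extend-< σ k k<v = proj₁ (σ-level0 (fromℕ< k<v))

  extend-depth : ∀ k → depth (extend σ k) ≤ 0
  extend-depth k with k <? v
  ... | yes k<v = proj₂ (σ-level0 (fromℕ< k<v))
  ... | no  _   = z≤n

∘ₛ-inverse-≈ : ∀ {v} (τ ς : Subst0 v) → (∀ i → (τ i ∘ₛ ς) ≈ var (toℕ i)) →
  ∀ φ → VarsBelow v φ → ((φ ∘ₛ τ) ∘ₛ ς) ≈ φ
∘ₛ-inverse-≈ {v} τ ς τς≈id φ vs
  rewrite subst-subst (extend ς) (extend τ) φ = subst-≈-id _ ρ≈id φ vs
  where
  ρ≈id : ∀ k → k < v → (extend τ k ∘ₛ ς) ≈ var k
  ρ≈id k k<v rewrite extend-< τ k k<v =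
    ≡-subst (λ n → (τ (fromℕ< k<v) ∘ₛ ς) ≈ var n) (toℕ-fromℕ< k<v) (τς≈id (fromℕ< k<v))

lookup-fromList : ∀ (φs : List Fm) i → lookup (fromList φs) i ≡ List.lookup φs i
lookup-fromList (φ ∷ φs) fzero    = refl
lookup-fromList (φ ∷ φs) (fsuc i) = lookup-fromList φs i

eval-disj : ∀ val m φs → eval val m (disj φs) ≡ or (List.map (eval val m) φs)
eval-disj val m []           = refl
eval-disj val m (φ ∷ [])     = sym (∨-identityʳ (eval val m φ))
eval-disj val m (φ ∷ ψ ∷ φs) = cong (eval val m φ ∨_) (eval-disj val m (ψ ∷ φs))

or-select-insert : ∀ (ev : Fm → Bool) {n} (t : Subset n) (φs : Vec Fm n) j →
  or (List.map ev (select (t [ j ]≔ true) φs)) ≡ or (List.map ev (select t φs)) ∨ ev (lookup φs j)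
or-select-insert ev (true  ∷ t) (φ ∷ φs) fzero    =
  sym (∨-absorbs-implied λ ev[φ] → cong (_∨ or (List.map ev (select t φs))) ev[φ])
or-select-insert ev (false ∷ t) (φ ∷ φs) fzero    = ∨-comm (ev φ) _
or-select-insert ev (true  ∷ t) (φ ∷ φs) (fsuc j) =
  trans (cong (ev φ ∨_) (or-select-insert ev t φs j)) (sym (∨-assoc (ev φ) _ _))
or-select-insert ev (false ∷ t) (φ ∷ φs) (fsuc j) = or-select-insert ev t φs j

eval-dcf-insert : ∀ v d (t : Subset (N v d)) j val m →
  eval val m (dcf v d (t [ j ]≔ true)) ≡ eval val m (dcf v d t) ∨ eval val m (mint v d j)
eval-dcf-insert v d t j val m = begin
  eval val m (dcf v d (t [ j ]≔ true))
    ≡⟨ eval-disj val m (select (t [ j ]≔ true) μs) ⟩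
  or (List.map (eval val m) (select (t [ j ]≔ true) μs))
    ≡⟨ or-select-insert (eval val m) t μs j ⟩
  or (List.map (eval val m) (select t μs)) ∨ eval val m (lookup μs j)
    ≡⟨ cong₂ _∨_ (sym (eval-disj val m (select t μs))) (cong (eval val m) (lookup-fromList (minterms v d) j)) ⟩
  eval val m (dcf v d t) ∨ eval val m (mint v d j) ∎
  where
  open ≡-Reasoning
  μs = fromList (minterms v d)

minterm⇒dcf : ∀ v d (t : Subset (N v d)) i → i ∈ₛ t → ⊢E (mint v d i ⇒′ dcf v d t)
minterm⇒dcf v d t i i∈t = tautology λ val m → ⇒-intro λ μ-holds → Holds⁺ (begin
  eval val m (dcf v d t)                            ≡⟨ cong (eval val m ∘ dcf v d) (sym t[i]≔true≡t) ⟩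
  eval val m (dcf v d (t [ i ]≔ true))              ≡⟨ eval-dcf-insert v d t i val m ⟩
  eval val m (dcf v d t) ∨ eval val m (mint v d i)  ≡⟨ cong (_ ∨_) (Holds⁻ μ-holds) ⟩
  eval val m (dcf v d t) ∨ true                     ≡⟨ ∨-zeroʳ _ ⟩
  true                                              ∎)
  where
  open ≡-Reasoning
  t[i]≔true≡t : t [ i ]≔ true ≡ t
  t[i]≔true≡t = trans (cong (t [ i ]≔_) (sym ([]=⇒lookup i∈t))) ([]≔-lookup t i)

InMinSet⇒⊢ : ∀ v d {φ i} → InMinSet v d φ i → ⊢E (mint v d i ⇒′ φ)
InMinSet⇒⊢ v d {i = i} (t , φ≈dcf , i∈t) = ⇒-trans (minterm⇒dcf v d t i i∈t) (≈⇒⇐ φ≈dcf)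

InMinSet-intro : ∀ v d {φ} (t : Subset (N v d)) j →
  φ ≈ dcf v d t → ⊢E (mint v d j ⇒′ φ) → InMinSet v d φ j
InMinSet-intro v d {φ} t j φ≈dcf μ⇒φ =
  t [ j ]≔ true , mp-tautological₂ φ≈dcf μ⇒φ φ≈dcf′ , []≔-updates t j
  where
  φ≈dcf′ : ∀ val m → Holds val m (φ ⇔′ dcf v d t) → Holds val m (mint v d j ⇒′ φ) →
    Holds val m (φ ⇔′ dcf v d (t [ j ]≔ true))
  φ≈dcf′ val m e₁ e₂ = ⇔-intro (begin
    eval val m φ                                      ≡⟨ sym (∨-absorbs-implied (Holds⁻ ∘ ⇒-elim e₂ ∘ Holds⁺)) ⟩
    eval val m φ ∨ eval val m (mint v d j)            ≡⟨ cong (_∨ _) (⇔-elim e₁) ⟩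
    eval val m (dcf v d t) ∨ eval val m (mint v d j)  ≡⟨ sym (eval-dcf-insert v d t j val m) ⟩
    eval val m (dcf v d (t [ j ]≔ true))              ∎)
    where open ≡-Reasoning

corollary6 : (v d : ℕ) (S : Fm → Set) → ClassicalModalLogic S →
    UnionOfPrimeOrbits v d (InChar S v d)
corollary6 v d S L i j i∈⟨S⟩ (ς , (_ , τ , τ-level0 , _ , τς≈id) , μᵢς≈μⱼ) φ φ∈S φ∈F =
  InMinSet-intro v d (proj₁ φ-minset) j (proj₁ (proj₂ φ-minset)) μⱼ⇒φ
  where
  open ClassicalModalLogic L

  φ-minset : InMinSet v d φ i
  φ-minset = i∈⟨S⟩ φ φ∈S φ∈F

  μᵢ⇒φτ : ⊢E (mint v d i ⇒′ (φ ∘ₛ τ))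
  μᵢ⇒φτ = InMinSet⇒⊢ v d (i∈⟨S⟩ (φ ∘ₛ τ) (closedUS (extend τ) φ∈S) (InF-∘ₛ τ τ-level0 φ φ∈F))

  μᵢς⇒φτς : ⊢E ((mint v d i ∘ₛ ς) ⇒′ ((φ ∘ₛ τ) ∘ₛ ς))
  μᵢς⇒φτς = us (extend ς) μᵢ⇒φτ

  μⱼ⇒φ : ⊢E (mint v d j ⇒′ φ)
  μⱼ⇒φ = ⇒-trans (≈⇒⇐ μᵢς≈μⱼ)
           (⇒-trans μᵢς⇒φτς (≈⇒⇒ (∘ₛ-inverse-≈ τ ς τς≈id φ (proj₁ φ∈F))))
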